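{- Let $\beta \geq 2$ be a fixed integer. For hypergraph orientation under explorable uncertainty with predictions, there is no deterministic $\beta$-robust algorithm that is $\alpha$-consistent for any $\alpha < 1 + \frac{1}{\beta}$. Conversely, no deterministic $\alpha$-consistent algorithm with $\alpha > 1$ is $\beta$-robust for any $\beta < \max\{\frac{1}{\alpha - 1}, 2\}$. These statements hold even when restricted to instances consisting of a single hyperedge, and also when restricted to instances where the hypergraph is a simple (non-hyper) graph.
   Context: Hypergraph orientation under explorable uncertainty: an instance is a hypergraph $H=(V,E)$ (each hyperedge $S\in E$ is a subset of $V$) together with, for every vertex $v$, an uncertainty interval $I_v$, which is either an open interval $(L_v,U_v)$ or a trivial interval $[w_v]=\{w_v\}$ (with $L_v=U_v=w_v$), and an initially unknown precise weight $w_v \in I_v$. Querying $v$ reveals $w_v$ and replaces $I_v$ by $[w_v]$. A hyperedge $S$ is solved (its orientation is known) with respect to the current intervals if there is $v\in S$ with $U_v \le L_u$ for all $u \in S\setminus\{v\}$; the task is to orient every hyperedge towards a vertex of minimum precise weight. A set $Q\subseteq V$ is feasible if after querying $Q$ all hyperedges are solved; $\mathrm{OPT}$ denotes a feasible set of minimum size. An algorithm adaptively queries vertices until all hyperedges are solved; it is $\rho$-competitive if on every instance it makes at most $\rho\cdot|\mathrm{OPT}|$ queries. In the prediction setting the algorithm is also given a predicted weight $\tilde{w}_v \in I_v$ for each $v$ (possibly wrong). An algorithm is $\alpha$-consistent if it is $\alpha$-competitive on all instances with $\tilde w_v = w_v$ for all $v$, and $\beta$-robust if it is $\beta$-competitive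 on all instances (arbitrary predictions).
   Formalization: The ratio α and, in the second statement, β range over ℚ, and the interval endpoints, the precise weights $w_v$ and the predicted weights $\tilde{w}_v$ are taken in ℚ. -}

module Defs where

open import Data.Nat as ℕ using (ℕ; zero; suc)
open import Data.Fin using (Fin)
open import Data.Fin.Subset using (Subset; _∈_; ∣_∣; ⁅_⁆; _∪_; ⊥)
open import Data.Fin.Subset.Properties using (_∈?_)
open import Data.List using (List; []; _∷_; _++_; length; foldr)
open import Data.List.Relation.Unary.All using (All)
open import Data.Integer using (+_)
open import Data.Maybe using (Maybe; just; nothing)
open import Data.Product using (Σ; ∃; ∃-syntax; _×_; _,_; proj₁)
open import Data.Rational as ℚ using (ℚ; 0ℚ; 1ℚ; _<_; _≤_; _-_; 1/_; _≟_)
open import Relation.Nullary using (¬_; yes; no)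
open import Relation.Binary.PropositionalEquality using (_≡_; _≢_)

data Interval : Set where
  open⟨_,_⟩ : (L U : ℚ) → Interval
  [_]       : (w : ℚ) → Interval

lower : Interval → ℚ
lower open⟨ L , U ⟩ = L
lower [ w ]         = w

upper : Interval → ℚ
upper open⟨ L , U ⟩ = U
upper [ w ]         = w

_∈I_ : ℚ → Interval → Set
x ∈I open⟨ L , U ⟩ = (L < x) × (x < U)
x ∈I [ w ]         = x ≡ w

Hypergraph : ℕ → Set
Hypergraph n = List (Subset n)

Solved : {n : ℕ} → (Fin n → Interval) → Subset n → Set
Solved I S = ∃[ v ] (v ∈ S × (∀ u → u ∈ S → u ≢ v → upper (I v) ≤ lower (I u)))

AllSolved : {n : ℕ} → (Fin n → Interval) → Hypergraph n → Set
AllSolved I E = All (Solved I) E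

record Instance : Set where
  field
    n         : ℕ
    edges     : Hypergraph n
    interval  : Fin n → Interval
    weight    : Fin n → ℚ
    weight∈   : ∀ v → weight v ∈I interval v
    predicted : Fin n → ℚ
    predicted∈ : ∀ v → predicted v ∈I interval v

open Instance public

revealed : (inst : Instance) → Subset (n inst) → Fin (n inst) → Interval
revealed inst Q v with v ∈? Q
... | yes _ = [ weight inst v ]
... | no  _ = interval inst v

Feasible : (inst : Instance) → Subset (n inst) → Set
Feasible inst Q = AllSolved (revealed inst Q) (edges inst)

IsOptSize : Instance → ℕ → Set
IsOptSize inst k =
  (∃[ Q ] (Feasible inst Q × ∣ Q ∣ ≡ k)) ×
  (∀ Q → Feasible inst Q → k ℕ.≤ ∣ Q ∣)

-- The algorithm sees everything except the hidden weights: the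
-- hypergraph, the initial intervals, the predictions, and the history of
-- queries made so far with their revealed weights.  It returns the next
-- vertex to query (or nothing = stop).

Algorithm : Set
Algorithm = (n : ℕ) → Hypergraph n → (Fin n → Interval) → (Fin n → ℚ)
          → List (Fin n × ℚ) → Maybe (Fin n)

history : Algorithm → (inst : Instance) → ℕ → List (Fin (n inst) × ℚ)
history A inst zero = []
history A inst (suc t) with A (n inst) (edges inst) (interval inst) (predicted inst) (history A inst t)
... | just v  = history A inst t ++ ((v , weight inst v) ∷ [])
... | nothing = history A inst t

queriedSet : {m : ℕ} → List (Fin m × ℚ) → Subset m
queriedSet = foldr (λ p Q → ⁅ proj₁ p ⁆ ∪ Q) ⊥

current : Algorithm → (inst : Instance) → ℕ → Fin (n inst) → Interval
current A inst t = revealed inst (queriedSet (history A inst t))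

QueryCount : Algorithm → Instance → ℕ → Set
QueryCount A inst t =
  AllSolved (current A inst t) (edges inst) ×
  (∀ t′ → t′ ℕ.< t → ¬ AllSolved (current A inst t′) (edges inst))

CompetitiveOn : Algorithm → ℚ → Instance → Set
CompetitiveOn A ρ inst =
  ∀ k → IsOptSize inst k →
  ∃[ t ] (QueryCount A inst t × (+ t ℚ./ 1) ≤ ρ ℚ.* (+ k ℚ./ 1))

data InstanceClass : Set where
  allInstances    : InstanceClass
  singleHyperedge : InstanceClass
  simpleGraph     : InstanceClass

InClass : InstanceClass → Instance → Set
InClass allInstances    inst = Data.Unit.⊤ where import Data.Unit
InClass singleHyperedge inst = length (edges inst) ≡ 1
InClass simpleGraph     inst = All (λ S → ∣ S ∣ ≡ 2) (edges inst)

CorrectPredictions : Instance → Set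
CorrectPredictions inst = ∀ v → predicted inst v ≡ weight inst v

Robust : InstanceClass → Algorithm → ℚ → Set
Robust C A β = ∀ inst → InClass C inst → CompetitiveOn A β inst

Consistent : InstanceClass → Algorithm → ℚ → Set
Consistent C A α =
  ∀ inst → InClass C inst → CorrectPredictions inst → CompetitiveOn A α inst

-- 1 / (α - 1)  (the value at α = 1 is irrelevant; only used for α > 1)
recipPred : ℚ → ℚ
recipPred α with α - 1ℚ ≟ 0ℚ
... | yes _ = 0ℚ
... | no ne = (1/ (α - 1ℚ)) {{ℚ.≢-nonZero ne}}

{-# OPTIONS --safe #-}
-- Adversary argument on a star whose centre has interval (0, 10) and whose m leaves have
-- interval (5, 20).  With the predicted weights (centre 7, leaves 15) every feasible query set
-- contains all leaves and OPT = m, so an algorithm that is done after at most m queries queries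
-- exactly the leaves and never the centre.  After m - 1 of its steps some leaf ℓ is unqueried;
-- moving the centre to 1 and ℓ to 7 changes nothing the algorithm has seen so far, so on this
-- deceiving instance it again spends m steps without querying the centre, although now every
-- feasible set contains the centre and OPT = 1.  Hence ratio < (m + 1) / m on the predicted
-- star and ratio < m + 1 on the deceiving stars are incompatible; m = β, respectively
-- m = ⌊β⌋ (or m = 1 when β < 2), gives the two bounds.
module Submission where

open import Defs
open import Data.Nat as ℕ using (ℕ; zero; suc; z≤n; s≤s)
import Data.Nat.Properties as ℕP
import Data.Nat.Coprimality as Coprime
import Data.Nat.DivMod as ℕ/
open import Data.Integer as ℤ using (+_)
import Data.Integer.Properties as ℤP
open import Data.Rational as ℚ using (ℚ; mkℚ; 0ℚ; 1ℚ; _<_; _≤_; _+_; _*_; _-_; _/_; _⊔_; 1/_)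
import Data.Rational.Properties as ℚP
open import Data.Rational.Solver using (module +-*-Solver)
open import Data.Fin as Fin using (Fin; zero; suc)
import Data.Fin.Properties as FinP
open import Data.Fin.Subset using (Subset; _∈_; _∉_; ∣_∣; ⁅_⁆; _∪_; ⊤; _⊆_; inside; outside)
open import Data.Fin.Subset.Properties
  using (_∈?_; ∣p∣≤∣x∷p∣; ∣⊥∣≡0; ∉⊥; ∈⊤; ∣⊤∣≡n; x∈⁅x⁆; x∈⁅y⁆⇒x≡y; ∣⁅x⁆∣≡1; x∈p∪q⁺; x∈p∪q⁻; p⊆q⇒∣p∣≤∣q∣)
import Data.Vec as Vec
open import Data.List using (List; []; _∷_; _++_; length; tabulate)
import Data.List.Properties as ListP
open import Data.List.Relation.Unary.All as All using (All)
open import Data.List.Relation.Unary.Any as Any using (Any)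
import Data.List.Relation.Unary.All.Properties as AllP
import Data.List.Relation.Unary.Any.Properties as AnyP
open import Data.Maybe using (Maybe; just; nothing)
open import Data.Product using (∃-syntax; _×_; _,_)
open import Data.Sum using (inj₁; inj₂)
open import Data.Empty using (⊥; ⊥-elim)
open import Data.Unit using (tt)
open import Function using (id; _∘_)
open import Relation.Nullary using (¬_; yes; no)
open import Relation.Nullary.Decidable using (from-yes; from-no)
open import Relation.Binary.PropositionalEquality

-- Unlike + k / 1, this is a normal form, so comparisons between literals compute.
fromℕ : ℕ → ℚ
fromℕ k = mkℚ (+ k) 0 (Coprime.sym (Coprime.1-coprimeTo k))

+k/1≡fromℕ : ∀ k → + k / 1 ≡ fromℕ k
+k/1≡fromℕ k = ℚP.normalize-coprime (Coprime.sym (Coprime.1-coprimeTo k))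

fromℕ-mono-< : ∀ {a b} → a ℕ.< b → fromℕ a < fromℕ b
fromℕ-mono-< {a} {b} a<b =
  ℚ.*<* (subst₂ ℤ._<_ (sym (ℤP.*-identityʳ (+ a))) (sym (ℤP.*-identityʳ (+ b))) (ℤ.+<+ a<b))

fromℕ-cancel-< : ∀ {a b} → fromℕ a < fromℕ b → a ℕ.< b
fromℕ-cancel-< {a} {b} a<b with ℚP.drop-*<* a<b
... | a*1<b*1 rewrite ℤP.*-identityʳ (+ a) | ℤP.*-identityʳ (+ b) = ℤP.drop‿+<+ a*1<b*1

fromℕ-suc : ∀ k → fromℕ k + 1ℚ ≡ fromℕ (suc k)
fromℕ-suc k = begin
  fromℕ k + 1ℚ         ≡⟨ cong (λ z → (z ℤ.+ + 1) / 1) (ℤP.*-identityʳ (+ k)) ⟩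
  + (k ℕ.+ 1) / 1      ≡⟨ +k/1≡fromℕ (k ℕ.+ 1) ⟩
  fromℕ (k ℕ.+ 1)      ≡⟨ cong fromℕ (ℕP.+-comm k 1) ⟩
  fromℕ (suc k)        ∎
  where open ≡-Reasoning

floor-fromℕ : ∀ p → 0ℚ ≤ p → ∃[ m ] (fromℕ m ≤ p × p < fromℕ (suc m))
floor-fromℕ (mkℚ ℤ.-[1+ _ ] _ _) 0≤p with ℤ.NonNegative.nonNeg (ℚ.nonNegative 0≤p)
... | ()
floor-fromℕ p@(mkℚ (+ a) d _) _ = m , m≤p , p<m+1
  where
  m : ℕ
  m = a ℕ/./ suc d
  m≤p : fromℕ m ≤ p
  m≤p = ℚ.*≤* (subst₂ ℤ._≤_ (ℤP.pos-* m (suc d)) (sym (ℤP.*-identityʳ (+ a)))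
                (ℤ.+≤+ (ℕ/.m/n*n≤m a (suc d))))
  a<[m+1]*d : a ℕ.< suc m ℕ.* suc d
  a<[m+1]*d = ℕP.≤-trans (s≤s (ℕP.≤-reflexive (ℕ/.m≡m%n+[m/n]*n a (suc d))))
                (ℕP.+-monoˡ-≤ (m ℕ.* suc d) (ℕ/.m%n<n a (suc d)))
  p<m+1 : p < fromℕ (suc m)
  p<m+1 = ℚ.*<* (subst₂ ℤ._<_ (sym (ℤP.*-identityʳ (+ a))) (ℤP.pos-* (suc m) (suc d))
                  (ℤ.+<+ a<[m+1]*d))

<1+1/n⇒*n<n+1 : ∀ n .{{_ : ℕ.NonZero n}} {α} → α < 1ℚ + (+ 1 / n) → α * fromℕ n < fromℕ (suc n)
<1+1/n⇒*n<n+1 n@(suc _) {α} α< = begin-strict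
  α * fromℕ n                    <⟨ ℚP.*-monoˡ-<-pos (fromℕ n) α< ⟩
  (1ℚ + (+ 1 / n)) * fromℕ n     ≡⟨ ℚP.*-distribʳ-+ (fromℕ n) 1ℚ (+ 1 / n) ⟩
  1ℚ * fromℕ n + (+ 1 / n) * fromℕ n
    ≡⟨ cong₂ _+_ (ℚP.*-identityˡ (fromℕ n)) (cong (_* fromℕ n) 1/n≡1/fromℕn) ⟩
  fromℕ n + 1/ (fromℕ n) * fromℕ n ≡⟨ cong (λ z → fromℕ n + z) (ℚP.*-inverseˡ (fromℕ n)) ⟩
  fromℕ n + 1ℚ                   ≡⟨ fromℕ-suc n ⟩
  fromℕ (suc n)                  ∎
  where
  open ℚP.≤-Reasoning
  1/n≡1/fromℕn : + 1 / n ≡ 1/ (fromℕ n)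
  1/n≡1/fromℕn = ℚP.normalize-coprime (Coprime.1-coprimeTo n)

1<p⇒0<p-1 : ∀ {p} → 1ℚ < p → 0ℚ < p - 1ℚ
1<p⇒0<p-1 = ℚP.+-monoˡ-< (ℚ.- 1ℚ)

<recipPred⇒*<1 : ∀ {α β} → 1ℚ < α → β < recipPred α → (α - 1ℚ) * β < 1ℚ
<recipPred⇒*<1 {α} {β} 1<α β<r with α - 1ℚ ℚ.≟ 0ℚ
... | yes α-1≡0 = ⊥-elim (ℚP.<-irrefl (sym α-1≡0) (1<p⇒0<p-1 1<α))
... | no α-1≢0 = subst ((α - 1ℚ) * β <_) (ℚP.*-inverseʳ (α - 1ℚ)) (ℚP.*-monoʳ-<-pos (α - 1ℚ) β<r)
  where
  instance
    α-1-positive : ℚ.Positive (α - 1ℚ)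
    α-1-positive = ℚ.positive (1<p⇒0<p-1 1<α)
    α-1-nonZero : ℚ.NonZero (α - 1ℚ)
    α-1-nonZero = ℚ.≢-nonZero α-1≢0

<recipPred⇒*m<m+1 : ∀ {α β} m → 1ℚ < α → β < recipPred α → fromℕ m ≤ β → α * fromℕ m < fromℕ (suc m)
<recipPred⇒*m<m+1 {α} {β} m 1<α β<r m≤β = begin-strict
  α * fromℕ m                   ≡⟨ split α (fromℕ m) ⟩
  (α - 1ℚ) * fromℕ m + fromℕ m  ≤⟨ ℚP.+-monoˡ-≤ (fromℕ m) (ℚP.*-monoˡ-≤-nonNeg (α - 1ℚ) m≤β) ⟩
  (α - 1ℚ) * β + fromℕ m        <⟨ ℚP.+-monoˡ-< (fromℕ m) (<recipPred⇒*<1 1<α β<r) ⟩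
  1ℚ + fromℕ m                  ≡⟨ ℚP.+-comm 1ℚ (fromℕ m) ⟩
  fromℕ m + 1ℚ                  ≡⟨ fromℕ-suc m ⟩
  fromℕ (suc m)                 ∎
  where
  open ℚP.≤-Reasoning
  open +-*-Solver
  split : ∀ a x → a * x ≡ (a - 1ℚ) * x + x
  split = solve 2 (λ a x → a :* x := (a :- con 1ℚ) :* x :+ x) refl
  instance
    α-1-nonNegative : ℚ.NonNegative (α - 1ℚ)
    α-1-nonNegative = ℚ.nonNegative (ℚP.<⇒≤ (1<p⇒0<p-1 1<α))

∣p∪q∣≤∣p∣+∣q∣ : ∀ {n} (p q : Subset n) → ∣ p ∪ q ∣ ℕ.≤ ∣ p ∣ ℕ.+ ∣ q ∣
∣p∪q∣≤∣p∣+∣q∣ Vec.[] Vec.[] = z≤n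
∣p∪q∣≤∣p∣+∣q∣ (outside Vec.∷ p) (outside Vec.∷ q) = ∣p∪q∣≤∣p∣+∣q∣ p q
∣p∪q∣≤∣p∣+∣q∣ (outside Vec.∷ p) (inside Vec.∷ q) =
  ℕP.≤-trans (s≤s (∣p∪q∣≤∣p∣+∣q∣ p q)) (ℕP.≤-reflexive (sym (ℕP.+-suc ∣ p ∣ ∣ q ∣)))
∣p∪q∣≤∣p∣+∣q∣ (inside Vec.∷ p) (x Vec.∷ q) =
  s≤s (ℕP.≤-trans (∣p∪q∣≤∣p∣+∣q∣ p q) (ℕP.+-monoʳ-≤ ∣ p ∣ (∣p∣≤∣x∷p∣ x q)))

∣queriedSet∣≤length : ∀ {m} (xs : List (Fin m × ℚ)) → ∣ queriedSet xs ∣ ℕ.≤ length xs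
∣queriedSet∣≤length {m} [] = ℕP.≤-reflexive (∣⊥∣≡0 m)
∣queriedSet∣≤length ((v , _) ∷ xs) = begin
  ∣ ⁅ v ⁆ ∪ queriedSet xs ∣           ≤⟨ ∣p∪q∣≤∣p∣+∣q∣ ⁅ v ⁆ (queriedSet xs) ⟩
  ∣ ⁅ v ⁆ ∣ ℕ.+ ∣ queriedSet xs ∣     ≡⟨ cong (ℕ._+ ∣ queriedSet xs ∣) (∣⁅x⁆∣≡1 v) ⟩
  suc ∣ queriedSet xs ∣               ≤⟨ s≤s (∣queriedSet∣≤length xs) ⟩
  suc (length xs)                     ∎
  where open ℕP.≤-Reasoning

queriedSet-++⁺ˡ : ∀ {m} (xs ys : List (Fin m × ℚ)) → queriedSet xs ⊆ queriedSet (xs ++ ys)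
queriedSet-++⁺ˡ [] ys x∈ = ⊥-elim (∉⊥ x∈)
queriedSet-++⁺ˡ ((v , _) ∷ xs) ys x∈ with x∈p∪q⁻ ⁅ v ⁆ (queriedSet xs) x∈
... | inj₁ x∈⁅v⁆ = x∈p∪q⁺ (inj₁ x∈⁅v⁆)
... | inj₂ x∈xs  = x∈p∪q⁺ (inj₂ (queriedSet-++⁺ˡ xs ys x∈xs))

∈queriedSet-∷ʳ : ∀ {m} (xs : List (Fin m × ℚ)) v w → v ∈ queriedSet (xs ++ (v , w) ∷ [])
∈queriedSet-∷ʳ [] v w = x∈p∪q⁺ (inj₁ (x∈⁅x⁆ v))
∈queriedSet-∷ʳ (_ ∷ xs) v w = x∈p∪q⁺ (inj₂ (∈queriedSet-∷ʳ xs v w))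

queriedSet-∷ʳ-weight : ∀ {m} (xs : List (Fin m × ℚ)) v a b →
                       queriedSet (xs ++ (v , a) ∷ []) ≡ queriedSet (xs ++ (v , b) ∷ [])
queriedSet-∷ʳ-weight [] v a b = refl
queriedSet-∷ʳ-weight ((u , _) ∷ xs) v a b = cong (⁅ u ⁆ ∪_) (queriedSet-∷ʳ-weight xs v a b)

nextQuery : Algorithm → (inst : Instance) → List (Fin (n inst) × ℚ) → Maybe (Fin (n inst))
nextQuery A inst = A (n inst) (edges inst) (interval inst) (predicted inst)

record-query : (inst : Instance) → Maybe (Fin (n inst)) → List (Fin (n inst) × ℚ) → List (Fin (n inst) × ℚ)
record-query inst (just v) h = h ++ (v , weight inst v) ∷ []
record-query inst nothing  h = h

history-suc : ∀ A inst t →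
  history A inst (suc t) ≡ record-query inst (nextQuery A inst (history A inst t)) (history A inst t)
history-suc A inst t with nextQuery A inst (history A inst t)
... | just v  = refl
... | nothing = refl

queried : Algorithm → (inst : Instance) → ℕ → Subset (n inst)
queried A inst t = queriedSet (history A inst t)

length-record-query : ∀ inst mv h → length (record-query inst mv h) ℕ.≤ suc (length h)
length-record-query inst (just v) h = ℕP.≤-reflexive (trans (ListP.length-++ h) (ℕP.+-comm (length h) 1))
length-record-query inst nothing  h = ℕP.n≤1+n (length h)

queriedSet-record-query : ∀ inst mv h → queriedSet h ⊆ queriedSet (record-query inst mv h)
queriedSet-record-query inst (just v) h = queriedSet-++⁺ˡ h _
queriedSet-record-query inst nothing  h = id

length-history≤ : ∀ A inst t → length (history A inst t) ℕ.≤ t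
length-history≤ A inst zero    = z≤n
length-history≤ A inst (suc t) = begin
  length (history A inst (suc t))   ≡⟨ cong length (history-suc A inst t) ⟩
  length (record-query inst next h) ≤⟨ length-record-query inst next h ⟩
  suc (length h)                    ≤⟨ s≤s (length-history≤ A inst t) ⟩
  suc t                             ∎
  where
  open ℕP.≤-Reasoning
  h : List (Fin (n inst) × ℚ)
  h = history A inst t
  next : Maybe (Fin (n inst))
  next = nextQuery A inst h

∣queried∣≤ : ∀ A inst t → ∣ queried A inst t ∣ ℕ.≤ t
∣queried∣≤ A inst t = ℕP.≤-trans (∣queriedSet∣≤length (history A inst t)) (length-history≤ A inst t)

⊆queried⇒∣∣≤ : ∀ A inst t {p} → p ⊆ queried A inst t → ∣ p ∣ ℕ.≤ t
⊆queried⇒∣∣≤ A inst t p⊆ = ℕP.≤-trans (p⊆q⇒∣p∣≤∣q∣ p⊆) (∣queried∣≤ A inst t)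

queried-suc : ∀ A inst t → queried A inst t ⊆ queried A inst (suc t)
queried-suc A inst t x∈ =
  subst (λ h → _ ∈ queriedSet h) (sym (history-suc A inst t))
        (queriedSet-record-query inst (nextQuery A inst (history A inst t)) (history A inst t) x∈)

queried-mono : ∀ A inst {s t} → s ℕ.≤ t → queried A inst s ⊆ queried A inst t
queried-mono A inst {t = zero}  z≤n = id
queried-mono A inst {t = suc t} s≤t with ℕP.m≤n⇒m<n∨m≡n s≤t
... | inj₁ s<t  = queried-suc A inst t ∘ queried-mono A inst (ℕP.≤-pred s<t)
... | inj₂ refl = id

nextQuery∈queried : ∀ A inst t {v} → nextQuery A inst (history A inst t) ≡ just v → v ∈ queried A inst (suc t)
nextQuery∈queried A inst t {v} next≡v rewrite history-suc A inst t | next≡v =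
  ∈queriedSet-∷ʳ (history A inst t) v (weight inst v)

∈I⇒lower≤ : ∀ {x} I → x ∈I I → lower I ≤ x
∈I⇒lower≤ open⟨ L , U ⟩ (L<x , _) = ℚP.<⇒≤ L<x
∈I⇒lower≤ [ w ]         refl      = ℚP.≤-refl

∈I⇒≤upper : ∀ {x} I → x ∈I I → x ≤ upper I
∈I⇒≤upper open⟨ L , U ⟩ (_ , x<U) = ℚP.<⇒≤ x<U
∈I⇒≤upper [ w ]         refl      = ℚP.≤-refl

weight∈revealed : ∀ inst Q v → weight inst v ∈I revealed inst Q v
weight∈revealed inst Q v with v ∈? Q
... | yes _ = refl
... | no  _ = weight∈ inst v

lower-revealed≤weight : ∀ inst Q v → lower (revealed inst Q v) ≤ weight inst v
lower-revealed≤weight inst Q v = ∈I⇒lower≤ (revealed inst Q v) (weight∈revealed inst Q v)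

weight≤upper-revealed : ∀ inst Q v → weight inst v ≤ upper (revealed inst Q v)
weight≤upper-revealed inst Q v = ∈I⇒≤upper (revealed inst Q v) (weight∈revealed inst Q v)

revealed-∈ : ∀ inst {Q v} → v ∈ Q → revealed inst Q v ≡ [ weight inst v ]
revealed-∈ inst {Q} {v} v∈Q with v ∈? Q
... | yes _   = refl
... | no  v∉Q = ⊥-elim (v∉Q v∈Q)

revealed-∉ : ∀ inst {Q v} → v ∉ Q → revealed inst Q v ≡ interval inst v
revealed-∉ inst {Q} {v} v∉Q with v ∈? Q
... | yes v∈Q = ⊥-elim (v∉Q v∈Q)
... | no  _   = refl

-- Indistinguishability

withWeight : (inst : Instance) (w : Fin (n inst) → ℚ) → (∀ v → w v ∈I interval inst v) → Instance
withWeight inst w w∈ = record inst { weight = w ; weight∈ = w∈ }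

withWeight-inClass : ∀ C inst w w∈ → InClass C inst → InClass C (withWeight inst w w∈)
withWeight-inClass allInstances    inst w w∈ = id
withWeight-inClass singleHyperedge inst w w∈ = id
withWeight-inClass simpleGraph     inst w w∈ = id

module _ (A : Algorithm) (inst : Instance) (w : Fin (n inst) → ℚ) (w∈ : ∀ v → w v ∈I interval inst v) where

  private
    inst′ : Instance
    inst′ = withWeight inst w w∈

  record-query-withWeight : ∀ mv h → (∀ {v} → mv ≡ just v → w v ≡ weight inst v) →
                            record-query inst′ mv h ≡ record-query inst mv h
  record-query-withWeight nothing  h _     = refl
  record-query-withWeight (just v) h agree = cong (λ x → h ++ (v , x) ∷ []) (agree refl)

  queriedSet-record-query-withWeight : ∀ mv h →
                                       queriedSet (record-query inst′ mv h) ≡ queriedSet (record-query inst mv h)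
  queriedSet-record-query-withWeight nothing  h = refl
  queriedSet-record-query-withWeight (just v) h = queriedSet-∷ʳ-weight h v (w v) (weight inst v)

  history-withWeight : ∀ t → (∀ v → v ∈ queried A inst t → w v ≡ weight inst v) →
                       history A inst′ t ≡ history A inst t
  history-withWeight zero    _     = refl
  history-withWeight (suc t) agree = begin
    history A inst′ (suc t)                             ≡⟨ history-suc A inst′ t ⟩
    record-query inst′ (next h′) h′                     ≡⟨ cong (λ h → record-query inst′ (next h) h) h′≡h ⟩
    record-query inst′ (next h) h
      ≡⟨ record-query-withWeight (next h) h (λ next≡v → agree _ (nextQuery∈queried A inst t next≡v)) ⟩
    record-query inst (next h) h                        ≡⟨ sym (history-suc A inst t) ⟩
    history A inst (suc t)                              ∎
    where
    open ≡-Reasoning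
    next : List (Fin (n inst) × ℚ) → Maybe (Fin (n inst))
    next = nextQuery A inst
    h h′ : List (Fin (n inst) × ℚ)
    h = history A inst t
    h′ = history A inst′ t
    h′≡h : h′ ≡ h
    h′≡h = history-withWeight t (λ v → agree v ∘ queried-suc A inst t)

  -- One step beyond the agreement window the revealed weight may differ, but the queried vertex does not.
  queried-withWeight : ∀ t → (∀ v → v ∈ queried A inst t → w v ≡ weight inst v) →
                       ∀ s → s ℕ.≤ suc t → queried A inst′ s ≡ queried A inst s
  queried-withWeight t agree s s≤t+1 with ℕP.m≤n⇒m<n∨m≡n s≤t+1
  ... | inj₁ s<t+1 = cong queriedSet
          (history-withWeight s (λ v → agree v ∘ queried-mono A inst (ℕP.≤-pred s<t+1)))
  ... | inj₂ refl = begin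
    queriedSet (history A inst′ (suc t))               ≡⟨ cong queriedSet (history-suc A inst′ t) ⟩
    queriedSet (record-query inst′ (next h′) h′)       ≡⟨ cong (λ h → queriedSet (record-query inst′ (next h) h)) h′≡h ⟩
    queriedSet (record-query inst′ (next h) h)         ≡⟨ queriedSet-record-query-withWeight (next h) h ⟩
    queriedSet (record-query inst (next h) h)          ≡⟨ cong queriedSet (sym (history-suc A inst t)) ⟩
    queriedSet (history A inst (suc t))                ∎
    where
    open ≡-Reasoning
    next : List (Fin (n inst) × ℚ) → Maybe (Fin (n inst))
    next = nextQuery A inst
    h h′ : List (Fin (n inst) × ℚ)
    h = history A inst t
    h′ = history A inst′ t
    h′≡h : h′ ≡ h
    h′≡h = history-withWeight t agree

-- The star instances

star : InstanceClass → (m : ℕ) → Hypergraph (suc m)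
star allInstances    m = ⊤ ∷ []
star singleHyperedge m = ⊤ ∷ []
star simpleGraph     m = tabulate (λ i → inside Vec.∷ ⁅ i ⁆)

centre∈star : ∀ C m → All (zero ∈_) (star C m)
centre∈star allInstances    m = Vec.here All.∷ All.[]
centre∈star singleHyperedge m = Vec.here All.∷ All.[]
centre∈star simpleGraph     m = AllP.tabulate⁺ (λ _ → Vec.here)

leaf∈star : ∀ C m (i : Fin m) → Any (suc i ∈_) (star C m)
leaf∈star allInstances    m i = Any.here ∈⊤
leaf∈star singleHyperedge m i = Any.here ∈⊤
leaf∈star simpleGraph     m i = AnyP.tabulate⁺ i (Vec.there (x∈⁅x⁆ i))

star-edge : ∀ C m {I} → AllSolved I (star C m) → ∀ i → ∃[ S ] (zero ∈ S × suc i ∈ S × Solved I S)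
star-edge C m solved i with All.lookupAny (All.zip (solved , centre∈star C m)) (leaf∈star C m i)
... | (S-solved , centre∈S) , leaf∈S = _ , centre∈S , leaf∈S , S-solved

leaves : ∀ m → Subset (suc m)
leaves m = outside Vec.∷ ⊤

starInterval : ∀ {m} → Fin (suc m) → Interval
starInterval zero    = open⟨ fromℕ 0 , fromℕ 10 ⟩
starInterval (suc _) = open⟨ fromℕ 5 , fromℕ 20 ⟩

-- The leaves lie above the centre's interval and the centre inside every leaf interval.
predictedWeight : ∀ {m} → Fin (suc m) → ℚ
predictedWeight zero    = fromℕ 7
predictedWeight (suc _) = fromℕ 15

predictedWeight∈ : ∀ {m} (v : Fin (suc m)) → predictedWeight v ∈I starInterval v
predictedWeight∈ zero    = from-yes (fromℕ 0 ℚ.<? fromℕ 7) , from-yes (fromℕ 7 ℚ.<? fromℕ 10)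
predictedWeight∈ (suc _) = from-yes (fromℕ 5 ℚ.<? fromℕ 15) , from-yes (fromℕ 15 ℚ.<? fromℕ 20)

-- The centre lies below every leaf interval and leaf ℓ inside the centre's interval.
deceivingWeight : ∀ {m} → Fin m → Fin (suc m) → ℚ
deceivingWeight ℓ zero    = fromℕ 1
deceivingWeight ℓ (suc i) with i Fin.≟ ℓ
... | yes _ = fromℕ 7
... | no  _ = fromℕ 15

deceivingWeight∈ : ∀ {m} (ℓ : Fin m) v → deceivingWeight ℓ v ∈I starInterval v
deceivingWeight∈ ℓ zero    = from-yes (fromℕ 0 ℚ.<? fromℕ 1) , from-yes (fromℕ 1 ℚ.<? fromℕ 10)
deceivingWeight∈ ℓ (suc i) with i Fin.≟ ℓ
... | yes _ = from-yes (fromℕ 5 ℚ.<? fromℕ 7) , from-yes (fromℕ 7 ℚ.<? fromℕ 20)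
... | no  _ = from-yes (fromℕ 5 ℚ.<? fromℕ 15) , from-yes (fromℕ 15 ℚ.<? fromℕ 20)

deceivingWeight-ℓ : ∀ {m} (ℓ : Fin m) → deceivingWeight ℓ (suc ℓ) ≡ fromℕ 7
deceivingWeight-ℓ ℓ with ℓ Fin.≟ ℓ
... | yes _   = refl
... | no  ℓ≢ℓ = ⊥-elim (ℓ≢ℓ refl)

deceivingWeight≡predictedWeight : ∀ {m} (ℓ : Fin m) v → v ≢ zero → v ≢ suc ℓ → deceivingWeight ℓ v ≡ predictedWeight v
deceivingWeight≡predictedWeight ℓ zero    v≢0 _ = ⊥-elim (v≢0 refl)
deceivingWeight≡predictedWeight ℓ (suc i) _ v≢ℓ with i Fin.≟ ℓ
... | yes refl = ⊥-elim (v≢ℓ refl)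
... | no  _    = refl

predictedStar : InstanceClass → ℕ → Instance
predictedStar C m = record
  { n = suc m ; edges = star C m ; interval = starInterval
  ; weight = predictedWeight ; weight∈ = predictedWeight∈
  ; predicted = predictedWeight ; predicted∈ = predictedWeight∈ }

deceivingStar : (C : InstanceClass) (m : ℕ) → Fin m → Instance
deceivingStar C m ℓ = withWeight (predictedStar C m) (deceivingWeight ℓ) (deceivingWeight∈ ℓ)

predictedStar-inClass : ∀ C m → InClass C (predictedStar C m)
predictedStar-inClass allInstances    m = tt
predictedStar-inClass singleHyperedge m = refl
predictedStar-inClass simpleGraph     m = AllP.tabulate⁺ (λ i → cong suc (∣⁅x⁆∣≡1 i))

centre-solves : ∀ {m} (I : Fin (suc m) → Interval) {S} → zero ∈ S →
                (∀ i → upper (I zero) ≤ lower (I (suc i))) → Solved I S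
centre-solves I centre∈S below = zero , centre∈S , λ where
  zero    _ 0≢0 → ⊥-elim (0≢0 refl)
  (suc i) _ _   → below i

leaves-feasible : ∀ C m → Feasible (predictedStar C m) (leaves m)
leaves-feasible C m = All.map (λ centre∈S → centre-solves (revealed P (leaves m)) centre∈S below) (centre∈star C m)
  where
  P : Instance
  P = predictedStar C m
  below : ∀ i → upper (revealed P (leaves m) zero) ≤ lower (revealed P (leaves m) (suc i))
  below i rewrite revealed-∉ P {leaves m} {zero} (λ ()) | revealed-∈ P {leaves m} (Vec.there (∈⊤ {x = i})) =
    from-yes (fromℕ 10 ℚ.≤? fromℕ 15)

centre-feasible : ∀ C m ℓ → Feasible (deceivingStar C m ℓ) ⁅ zero ⁆
centre-feasible C m ℓ = All.map (λ centre∈S → centre-solves (revealed D ⁅ zero ⁆) centre∈S below) (centre∈star C m)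
  where
  D : Instance
  D = deceivingStar C m ℓ
  below : ∀ i → upper (revealed D ⁅ zero ⁆ zero) ≤ lower (revealed D ⁅ zero ⁆ (suc i))
  below i rewrite revealed-∈ D {⁅ zero ⁆} (x∈⁅x⁆ zero) | revealed-∉ D {⁅ zero ⁆} {suc i} (λ { (Vec.there i∈⊥) → ∉⊥ i∈⊥ }) =
    from-yes (fromℕ 1 ℚ.≤? fromℕ 5)

predictedStar-unsolved : ∀ C m {Q S} i → zero ∈ S → suc i ∈ S → suc i ∉ Q →
                         ¬ Solved (revealed (predictedStar C m) Q) S
predictedStar-unsolved C m {Q} i _ leaf∈S leaf∉Q (zero , _ , below) =
  from-no (fromℕ 7 ℚ.≤? fromℕ 5) (begin
    fromℕ 7                   ≤⟨ weight≤upper-revealed P Q zero ⟩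
    upper (revealed P Q zero)      ≤⟨ below (suc i) leaf∈S (λ ()) ⟩
    lower (revealed P Q (suc i))   ≡⟨ cong lower (revealed-∉ P leaf∉Q) ⟩
    fromℕ 5                   ∎)
  where
  open ℚP.≤-Reasoning
  P : Instance
  P = predictedStar C m
predictedStar-unsolved C m {Q} i centre∈S _ _ (suc j , _ , below) =
  from-no (fromℕ 15 ℚ.≤? fromℕ 7) (begin
    fromℕ 15                       ≤⟨ weight≤upper-revealed P Q (suc j) ⟩
    upper (revealed P Q (suc j))   ≤⟨ below zero centre∈S (λ ()) ⟩
    lower (revealed P Q zero)      ≤⟨ lower-revealed≤weight P Q zero ⟩
    fromℕ 7                        ∎)
  where
  open ℚP.≤-Reasoning
  P : Instance
  P = predictedStar C m

deceivingStar-unsolved : ∀ C m ℓ {Q S} → zero ∈ S → suc ℓ ∈ S → zero ∉ Q →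
                         ¬ Solved (revealed (deceivingStar C m ℓ) Q) S
deceivingStar-unsolved C m ℓ {Q} _ leaf∈S centre∉Q (zero , _ , below) =
  from-no (fromℕ 10 ℚ.≤? fromℕ 7) (begin
    fromℕ 10                       ≡⟨ cong upper (revealed-∉ D centre∉Q) ⟨
    upper (revealed D Q zero)      ≤⟨ below (suc ℓ) leaf∈S (λ ()) ⟩
    lower (revealed D Q (suc ℓ))   ≤⟨ lower-revealed≤weight D Q (suc ℓ) ⟩
    deceivingWeight ℓ (suc ℓ)      ≡⟨ deceivingWeight-ℓ ℓ ⟩
    fromℕ 7                        ∎)
  where
  open ℚP.≤-Reasoning
  D : Instance
  D = deceivingStar C m ℓ
deceivingStar-unsolved C m ℓ {Q} centre∈S _ centre∉Q (suc j , _ , below) =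
  from-no (fromℕ 5 ℚ.≤? fromℕ 0) (begin
    fromℕ 5                        ≤⟨ ∈I⇒lower≤ (starInterval (suc j)) (deceivingWeight∈ ℓ (suc j)) ⟩
    deceivingWeight ℓ (suc j)      ≤⟨ weight≤upper-revealed D Q (suc j) ⟩
    upper (revealed D Q (suc j))   ≤⟨ below zero centre∈S (λ ()) ⟩
    lower (revealed D Q zero)      ≡⟨ cong lower (revealed-∉ D centre∉Q) ⟩
    fromℕ 0                        ∎)
  where
  open ℚP.≤-Reasoning
  D : Instance
  D = deceivingStar C m ℓ

predictedStar-feasible⇒leaves⊆ : ∀ C m {Q} → Feasible (predictedStar C m) Q → leaves m ⊆ Q
predictedStar-feasible⇒leaves⊆ C m {Q} feasible {suc i} _ with suc i ∈? Q | star-edge C m {revealed (predictedStar C m) Q} feasible i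
... | yes leaf∈Q | _                                = leaf∈Q
... | no  leaf∉Q | _ , centre∈S , leaf∈S , S-solved =
  ⊥-elim (predictedStar-unsolved C m i centre∈S leaf∈S leaf∉Q S-solved)

deceivingStar-feasible⇒centre∈ : ∀ C m ℓ {Q} → Feasible (deceivingStar C m ℓ) Q → zero ∈ Q
deceivingStar-feasible⇒centre∈ C m ℓ {Q} feasible with zero ∈? Q | star-edge C m {revealed (deceivingStar C m ℓ) Q} feasible ℓ
... | yes centre∈Q | _                                = centre∈Q
... | no  centre∉Q | _ , centre∈S , leaf∈S , S-solved =
  ⊥-elim (deceivingStar-unsolved C m ℓ centre∈S leaf∈S centre∉Q S-solved)

predictedStar-opt : ∀ C m → IsOptSize (predictedStar C m) m
predictedStar-opt C m =
  (leaves m , leaves-feasible C m , ∣⊤∣≡n m) ,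
  λ Q feasible → subst (ℕ._≤ ∣ Q ∣) (∣⊤∣≡n m) (p⊆q⇒∣p∣≤∣q∣ (predictedStar-feasible⇒leaves⊆ C m feasible))

deceivingStar-opt : ∀ C m ℓ → IsOptSize (deceivingStar C m ℓ) 1
deceivingStar-opt C m ℓ =
  (⁅ zero ⁆ , centre-feasible C m ℓ , ∣⁅x⁆∣≡1 {n = suc m} zero) ,
  λ Q feasible → subst (ℕ._≤ ∣ Q ∣) (∣⁅x⁆∣≡1 {n = suc m} zero) (p⊆q⇒∣p∣≤∣q∣ (λ x∈⁅0⁆ →
    subst (_∈ Q) (sym (x∈⁅y⁆⇒x≡y zero x∈⁅0⁆)) (deceivingStar-feasible⇒centre∈ C m ℓ feasible)))

-- The adversary argument

∃-leaf∉ : ∀ {m} (Q : Subset (suc m)) → ∣ Q ∣ ℕ.< m → ∃[ ℓ ] suc ℓ ∉ Q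
∃-leaf∉ {m} Q ∣Q∣<m with FinP.all? (λ i → suc i ∈? Q)
... | yes leaves∈Q = ⊥-elim (ℕP.<⇒≱ ∣Q∣<m (subst (ℕ._≤ ∣ Q ∣) (∣⊤∣≡n m) (p⊆q⇒∣p∣≤∣q∣ leaves⊆Q)))
  where
  leaves⊆Q : leaves m ⊆ Q
  leaves⊆Q {suc i} _ = leaves∈Q i
... | no ¬leaves∈Q = FinP.¬∀⟶∃¬ m (λ i → suc i ∈ Q) (λ i → suc i ∈? Q) ¬leaves∈Q

predictedStar-fast⇒centre∉ : ∀ C m A {t} → QueryCount A (predictedStar C (suc m)) t → t ℕ.≤ suc m →
                             zero ∉ queried A (predictedStar C (suc m)) (suc m)
predictedStar-fast⇒centre∉ C m A {t} (solved , _) t≤m+1 centre∈ =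
  ℕP.<-irrefl refl (subst (ℕ._≤ suc m) (∣⊤∣≡n (suc (suc m))) (⊆queried⇒∣∣≤ A P (suc m) ⊤⊆))
  where
  P : Instance
  P = predictedStar C (suc m)
  t≡m+1 : t ≡ suc m
  t≡m+1 = ℕP.≤-antisym t≤m+1 (subst (ℕ._≤ t) (∣⊤∣≡n (suc m))
            (⊆queried⇒∣∣≤ A P t (predictedStar-feasible⇒leaves⊆ C (suc m) solved)))
  ⊤⊆ : ⊤ ⊆ queried A P (suc m)
  ⊤⊆ {zero}  _ = centre∈
  ⊤⊆ {suc i} _ = subst (λ s → suc i ∈ queried A P s) t≡m+1
                   (predictedStar-feasible⇒leaves⊆ C (suc m) solved (Vec.there ∈⊤))

deceivingStar-queried : ∀ C m A ℓ →
  zero ∉ queried A (predictedStar C (suc m)) (suc m) → suc ℓ ∉ queried A (predictedStar C (suc m)) m →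
  ∀ s → s ℕ.≤ suc m → queried A (deceivingStar C (suc m) ℓ) s ≡ queried A (predictedStar C (suc m)) s
deceivingStar-queried C m A ℓ centre∉ ℓ∉ =
  queried-withWeight A (predictedStar C (suc m)) (deceivingWeight ℓ) (deceivingWeight∈ ℓ) m agree
  where
  agree : ∀ v → v ∈ queried A (predictedStar C (suc m)) m → deceivingWeight ℓ v ≡ predictedWeight v
  agree v v∈ = deceivingWeight≡predictedWeight ℓ v
    (λ { refl → centre∉ (queried-mono A (predictedStar C (suc m)) (ℕP.n≤1+n m) v∈) }) (λ { refl → ℓ∉ v∈ })

star-lower-bound : ∀ C m A →
  ∃[ t ] (QueryCount A (predictedStar C (suc m)) t × t ℕ.≤ suc m) →
  (∀ ℓ → ∃[ t ] (QueryCount A (deceivingStar C (suc m) ℓ) t × t ℕ.≤ suc m)) → ⊥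
star-lower-bound C m A (t , P-count , t≤m+1) D-fast
  with ∃-leaf∉ (queried A (predictedStar C (suc m)) m) (s≤s (∣queried∣≤ A (predictedStar C (suc m)) m))
... | ℓ , ℓ∉ with D-fast ℓ
... | t′ , (D-solved , _) , t′≤m+1 =
  centre∉ (queried-mono A (predictedStar C (suc m)) t′≤m+1
    (subst (zero ∈_) (deceivingStar-queried C m A ℓ centre∉ ℓ∉ t′ t′≤m+1)
      (deceivingStar-feasible⇒centre∈ C (suc m) ℓ D-solved)))
  where
  centre∉ : zero ∉ queried A (predictedStar C (suc m)) (suc m)
  centre∉ = predictedStar-fast⇒centre∉ C m A P-count t≤m+1

competitive⇒count≤ : ∀ {A inst k} ρ m → CompetitiveOn A ρ inst → IsOptSize inst k →
                     ρ * fromℕ k < fromℕ (suc m) → ∃[ t ] (QueryCount A inst t × t ℕ.≤ m)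
competitive⇒count≤ {k = k} ρ m competitive opt ρk<m+1 with competitive k opt
... | t , count , t≤ρk = t , count , ℕP.≤-pred (fromℕ-cancel-< (begin-strict
  fromℕ t        ≡⟨ +k/1≡fromℕ t ⟨
  + t / 1        ≤⟨ t≤ρk ⟩
  ρ * (+ k / 1)  ≡⟨ cong (ρ *_) (+k/1≡fromℕ k) ⟩
  ρ * fromℕ k    <⟨ ρk<m+1 ⟩
  fromℕ (suc m)  ∎))
  where open ℚP.≤-Reasoning

robust⇒deceivingStar-count≤ : ∀ {C A β} m → Robust C A β → β < fromℕ (suc (suc m)) →
  ∀ ℓ → ∃[ t ] (QueryCount A (deceivingStar C (suc m) ℓ) t × t ℕ.≤ suc m)
robust⇒deceivingStar-count≤ {C} {β = β} m robust β<m+2 ℓ =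
  competitive⇒count≤ β (suc m)
    (robust (deceivingStar C (suc m) ℓ) (withWeight-inClass C _ _ _ (predictedStar-inClass C (suc m))))
    (deceivingStar-opt C (suc m) ℓ)
    (subst (_< fromℕ (suc (suc m))) (sym (ℚP.*-identityʳ β)) β<m+2)

consistency-lower-bound : ∀ C (β : ℕ) .{{_ : ℕ.NonZero β}} → 2 ℕ.≤ β → ∀ α → α < 1ℚ + (+ 1 / β) →
                          ¬ (∃[ A ] (Robust C A (+ β / 1) × Consistent C A α))
consistency-lower-bound C β@(suc m) _ α α<1+1/β (A , robust , consistent) =
  star-lower-bound C m A
    (competitive⇒count≤ α β (consistent (predictedStar C β) (predictedStar-inClass C β) (λ _ → refl))
      (predictedStar-opt C β) (<1+1/n⇒*n<n+1 β α<1+1/β))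
    (robust⇒deceivingStar-count≤ m robust
      (subst (_< fromℕ (suc β)) (sym (+k/1≡fromℕ β)) (fromℕ-mono-< ℕP.≤-refl)))

robustness-lower-bound : ∀ C α → 1ℚ < α → ∀ β → β < recipPred α ⊔ (+ 2 / 1) →
                         ¬ (∃[ A ] (Consistent C A α × Robust C A β))
robustness-lower-bound C α 1<α β β<max (A , consistent , robust) with β ℚ.<? fromℕ 2
... | yes β<2 = star-lower-bound C 0 A
      (competitive⇒count≤ β 1 (robust (predictedStar C 1) (predictedStar-inClass C 1)) (predictedStar-opt C 1)
        (subst (_< fromℕ 2) (sym (ℚP.*-identityʳ β)) β<2))
      (robust⇒deceivingStar-count≤ 0 robust β<2)
... | no β≮2 with floor-fromℕ β (ℚP.≤-trans (from-yes (0ℚ ℚ.≤? fromℕ 2)) (ℚP.≮⇒≥ β≮2))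
...   | zero  , _ , β<1 = β≮2 (ℚP.<-trans β<1 (from-yes (fromℕ 1 ℚ.<? fromℕ 2)))
...   | suc m , m+1≤β , β<m+2 = star-lower-bound C m A
      (competitive⇒count≤ α (suc m)
        (consistent (predictedStar C (suc m)) (predictedStar-inClass C (suc m)) (λ _ → refl))
        (predictedStar-opt C (suc m)) (<recipPred⇒*m<m+1 (suc m) 1<α β<recipPred m+1≤β))
      (robust⇒deceivingStar-count≤ m robust β<m+2)
  where
  β<recipPred : β < recipPred α
  β<recipPred with ℚP.⊔-sel (recipPred α) (+ 2 / 1)
  ... | inj₁ max≡recipPred = subst (β <_) max≡recipPred β<max
  ... | inj₂ max≡2 = ⊥-elim (β≮2 (subst (β <_) (trans max≡2 (+k/1≡fromℕ 2)) β<max))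

theorem1 :
    (C : InstanceClass) →
    ((β : ℕ) .{{_ : ℕ.NonZero β}} → 2 ℕ.≤ β → (α : ℚ) → α < 1ℚ + (+ 1 / β) →
      ¬ (∃[ A ] (Robust C A (+ β / 1) × Consistent C A α)))
    ×
    ((α : ℚ) → 1ℚ < α → (β : ℚ) → β < (recipPred α ⊔ (+ 2 / 1)) →
      ¬ (∃[ A ] (Consistent C A α × Robust C A β)))
theorem1 C = (λ β → consistency-lower-bound C β) , robustness-lower-bound C
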